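{- Consider any instance of the source detection game (with known or unknown static graph, and with consistent or obliviously dynamic source behavior) on $n$ nodes. There is a Discoverer strategy which, upon termination, has watched a node in a round in which that node got infected, and which terminates after tolerating at most $3n/2$ infections in expectation.
   Context: A simple temporal graph $(V,E,\lambda)$ with lifetime $T_{\max}$ has labeling $\lambda\colon E\to\{1,\dots,T_{\max}\}$; edge $e$ exists only at time $\lambda(e)$. SIR model with parameter $\delta$: nodes start susceptible; a seed $(v,t)$ infects $v$ at time $t$; a susceptible $u$ becomes infected at time $t$ iff a neighbor $v$ is infectious at time $t$ and $\lambda(uv)=t$; a node infected at time $t$ is infectious at $t+1,\dots,t+\delta$ and resistant afterwards. Source detection game: the Adversary picks $V$ ($|V|=n$), $T_{\max}$, $\delta$, static edges $E$, labeling $\lambda$ and a fixed source $s$; in round $i$ the process is run with the single seed $(s,t_i)$, where either $t_i=t_0$ for all rounds (consistent behavior) or the $t_i$ may vary but are chosen independently of the Discoverer's choices (obliviously dynamic behavior). Before each round the Discoverer chooses one node to watch and learns whether, when and by which neighbor (or by seeding) it was infected; it initially knows $V,T_{\max},\delta$, and in the known-graph variant also $E$. The number of infections tolerated is the total number of nodes infected, summed over all rounds played. -}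

module Defs where

open import Data.Nat using (ℕ; zero; suc; _+_; _*_; _≤_; _≤ᵇ_; _<ᵇ_; _≡ᵇ_)
open import Data.Bool using (Bool; true; false; _∧_; if_then_else_)
open import Data.Fin using (Fin; _≟_)
open import Data.List using (List; []; _∷_; _++_; [_]; length; map; allFin)
open import Data.Nat.ListAction using (sum)
open import Data.List.NonEmpty using (List⁺; toList)
open import Data.List.Relation.Unary.All using (All)
open import Data.List.Relation.Unary.Any using (Any)
open import Data.Maybe using (Maybe; just; nothing; is-just)
open import Data.Product using (Σ; _×_; _,_; proj₁; proj₂)
open import Data.Unit using (⊤; tt)
open import Relation.Nullary.Decidable using (⌊_⌋)
open import Relation.Binary.PropositionalEquality using (_≡_)

record Graph (n : ℕ) : Set where
  field
    adj        : Fin n → Fin n → Bool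
    adj-sym    : ∀ u v → adj u v ≡ adj v u
    adj-irrefl : ∀ v → adj v v ≡ false
open Graph public

-- A labeling λ : E → {1,…,Tmax}; only its values on edges matter.
record Labeling {n : ℕ} (G : Graph n) (Tmax : ℕ) : Set where
  field
    lab       : Fin n → Fin n → ℕ
    lab-sym   : ∀ u v → adj G u v ≡ true → lab u v ≡ lab v u
    lab-low   : ∀ u v → adj G u v ≡ true → 1 ≤ lab u v
    lab-high  : ∀ u v → adj G u v ≡ true → lab u v ≤ Tmax
open Labeling public

data Cause (n : ℕ) : Set where
  seeded : Cause n
  by     : Fin n → Cause n

-- What the Discoverer learns about a watched node:
-- nothing = not infected; just (t , c) = infected at time t with cause c.
Obs : ℕ → Set
Obs n = Maybe (ℕ × Cause n)

firstJust : {A B : Set} → List A → (A → Maybe B) → Maybe B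
firstJust []       f = nothing
firstJust (x ∷ xs) f with f x
... | just b  = just b
... | nothing = firstJust xs f

module SIR {n : ℕ} (G : Graph n) (lab : Fin n → Fin n → ℕ) (δ : ℕ)
           (s : Fin n) (t₀ : ℕ) where

  infectious : (Fin n → Obs n) → Fin n → ℕ → Bool
  infectious σ v t with σ v
  ... | nothing        = false
  ... | just (t' , _)  = (t' <ᵇ t) ∧ (t ≤ᵇ t' + δ)

  -- transition processing time step (suc t), from the state after time t
  step : ℕ → (Fin n → Obs n) → Fin n → Obs n
  step t σ u with σ u
  ... | just x  = just x
  ... | nothing =
    if ⌊ u ≟ s ⌋ ∧ (suc t ≡ᵇ t₀)
    then just (suc t , seeded)
    else firstJust (allFin n) (λ v →
           if adj G u v ∧ (lab u v ≡ᵇ suc t) ∧ infectious σ v (suc t)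
           then just (suc t , by v) else nothing)

  stateAfter : ℕ → Fin n → Obs n
  stateAfter zero    u = nothing
  stateAfter (suc t) u = step t (stateAfter t) u

finalObs : {n : ℕ} (G : Graph n) (lab : Fin n → Fin n → ℕ) (δ : ℕ)
           (s : Fin n) (t₀ : ℕ) (Tmax : ℕ) → Fin n → Obs n
finalObs G lab δ s t₀ Tmax = SIR.stateAfter G lab δ s t₀ Tmax

infectedCount : {n : ℕ} (G : Graph n) (lab : Fin n → Fin n → ℕ) (δ : ℕ)
                (s : Fin n) (t₀ : ℕ) (Tmax : ℕ) → ℕ
infectedCount {n} G lab δ s t₀ Tmax =
  sum (map (λ u → if is-just (finalObs G lab δ s t₀ Tmax u) then 1 else 0) (allFin n))

-- History: list of (watched node , observation), oldest first.
History : ℕ → Set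
History n = List (Fin n × Obs n)

-- Deterministic Discoverer strategy: given the history, stop (nothing)
-- or watch a node in the next round.
Strategy : ℕ → Set
Strategy n = History n → Maybe (Fin n)

-- Randomized strategy: uniform distribution over a nonempty finite list of
-- deterministic strategies (repetitions allowed, so any rational distribution).
RandStrategy : ℕ → Set
RandStrategy n = List⁺ (Strategy n)

data Knowledge : Set where
  knownGraph unknownGraph : Knowledge

Info : Knowledge → ℕ → Set
Info knownGraph   n = Graph n
Info unknownGraph n = ⊤

info : (k : Knowledge) {n : ℕ} → Graph n → Info k n
info knownGraph   G = G
info unknownGraph G = tt

data Behaviour : Set where
  consistent obliviouslyDynamic : Behaviour

-- Admissible seed-time sequences (round i ↦ t_i), fixed in advance by the Adversary.
ValidSeeds : Behaviour → ℕ → (ℕ → ℕ) → Set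
ValidSeeds consistent         Tmax ts =
  (∀ i → 1 ≤ ts i × ts i ≤ Tmax) × (∀ i → ts i ≡ ts 0)
ValidSeeds obliviouslyDynamic Tmax ts =
  ∀ i → 1 ≤ ts i × ts i ≤ Tmax

data Run (n : ℕ) : Set where
  done  : History n → Run n
  going : History n → Run n

hist : {n : ℕ} → Run n → History n
hist (done h)  = h
hist (going h) = h

IsDone : {n : ℕ} → Run n → Set
IsDone (done h)  = ⊤
IsDone (going h) = Data.Empty.⊥
  where import Data.Empty

module Game {n : ℕ} (G : Graph n) (lab : Fin n → Fin n → ℕ) (δ : ℕ)
            (s : Fin n) (Tmax : ℕ) (ts : ℕ → ℕ) where

  -- observation of node w in round i (rounds indexed from 0)
  observe : ℕ → Fin n → Obs n
  observe i w = finalObs G lab δ s (ts i) Tmax w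

  run : Strategy n → ℕ → Run n
  run σ zero = going []
  run σ (suc k) with run σ k
  ... | done h  = done h
  ... | going h with σ h
  ...   | nothing = done h
  ...   | just w  = going (h ++ [ (w , observe (length h) w) ])

  costRounds : ℕ → ℕ
  costRounds zero    = 0
  costRounds (suc r) = costRounds r + infectedCount G lab δ s (ts r) Tmax

  cost : History n → ℕ
  cost h = costRounds (length h)

  Success : History n → Set
  Success h = Any (λ p → is-just (proj₂ p) ≡ true) h

  Wins : RandStrategy n → Set
  Wins D =
    Σ ℕ λ K →
      All (λ σ → IsDone (run σ K)) (toList D) ×
      All (λ σ → Success (hist (run σ K))) (toList D) ×
      2 * sum (map (λ σ → cost (hist (run σ K))) (toList D))
        ≤ 3 * n * length (toList D)

-- The Discoverer watches R = n (n + 1) uniformly random nodes, one per round, and then every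
-- node once, stopping at the first watched node that is infected. The seed alone infects the
-- source in every round, hence the final phase guarantees success.
-- If c_i nodes are infected in round i, a random watch hits with probability c_i / n, so the
-- random phase costs Σ_i c_i Π_{j<i} (1 - c_j / n) = n (1 - Π_j (1 - c_j / n)) ≤ n in expectation.
-- The final phase costs at most n² and is reached with probability at most (1 - 1/n)^R ≤ 1/(2n).
-- Expectations are sums over the n^R equally likely choices of the random nodes.

module Submission where

open import Defs
open import Data.Nat using (ℕ; zero; suc; _+_; _*_; _^_; _∸_; _≤_; _<_; _≡ᵇ_; z≤n; s≤s; z<s)
open import Data.Nat.Properties hiding (_≟_)
open import Data.Nat.ListAction using (sum)
open import Data.Nat.ListAction.Properties using (sum-++)
open import Data.Nat.Solver using (module +-*-Solver)
open import Data.Bool using (Bool; true; false; not; _∨_; if_then_else_)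
open import Data.Bool.Properties using (∨-zeroʳ; ∨-identityʳ; T-≡)
open import Data.Fin as Fin using (Fin)
open import Data.List using (List; []; _∷_; _++_; [_]; length; map; allFin; drop; head; cartesianProductWith)
open import Data.Bool.ListAction using (any)
open import Data.List.Properties using (length-++; length-map; map-++; map-∘; ++-assoc; ++-identityʳ; length-tabulate; map-cong; map-cong-local)
open import Data.List.NonEmpty using (List⁺; toList; _∷_)
open import Data.List.Relation.Unary.All using (All; []; _∷_)
import Data.List.Relation.Unary.All as All
import Data.List.Relation.Unary.All.Properties as All
open import Data.List.Relation.Unary.Any using (here; there)
open import Data.List.Membership.Propositional using (_∈_)
open import Data.List.Membership.Propositional.Properties using (∈-allFin; ∈-++⁺ʳ)
open import Data.Maybe using (just; nothing; is-just)
open import Data.Product using (Σ; _×_; _,_; proj₁; proj₂)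
open import Data.Sum using (inj₁; inj₂)
open import Data.Unit using (tt)
open import Function using (_∘_; id; Equivalence)
open import Relation.Nullary using (yes; no; contradiction)
open import Relation.Binary.PropositionalEquality hiding ([_])

private
  variable
    A B C : Set

sum-map-+ : (f g : A → ℕ) (xs : List A) →
            sum (map (λ x → f x + g x) xs) ≡ sum (map f xs) + sum (map g xs)
sum-map-+ f g []       = refl
sum-map-+ f g (x ∷ xs) = begin
  (f x + g x) + sum (map (λ x → f x + g x) xs)   ≡⟨ cong ((f x + g x) +_) (sum-map-+ f g xs) ⟩
  (f x + g x) + (sum (map f xs) + sum (map g xs)) ≡⟨ +-*-Solver.solve 4 (λ a b c d → (a :+ b) :+ (c :+ d) := (a :+ c) :+ (b :+ d)) refl (f x) (g x) _ _ ⟩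
  (f x + sum (map f xs)) + (g x + sum (map g xs)) ∎
  where open ≡-Reasoning
        open +-*-Solver

sum-map-const : (k : ℕ) (xs : List A) → sum (map (λ _ → k) xs) ≡ length xs * k
sum-map-const k []       = refl
sum-map-const k (x ∷ xs) = cong (k +_) (sum-map-const k xs)

countᵇ : (A → Bool) → List A → ℕ
countᵇ b xs = sum (map (λ x → if b x then 1 else 0) xs)

countᵇ≤length : (b : A → Bool) (xs : List A) → countᵇ b xs ≤ length xs
countᵇ≤length b []       = z≤n
countᵇ≤length b (x ∷ xs) with b x
... | true  = s≤s (countᵇ≤length b xs)
... | false = m≤n⇒m≤1+n (countᵇ≤length b xs)

countᵇ+countᵇ-not : (b : A → Bool) (xs : List A) → countᵇ b xs + countᵇ (not ∘ b) xs ≡ length xs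
countᵇ+countᵇ-not b []       = refl
countᵇ+countᵇ-not b (x ∷ xs) with b x
... | true  = cong suc (countᵇ+countᵇ-not b xs)
... | false = trans (+-suc (countᵇ b xs) _) (cong suc (countᵇ+countᵇ-not b xs))

countᵇ-∈ : (b : A → Bool) {x : A} {xs : List A} → x ∈ xs → b x ≡ true → 1 ≤ countᵇ b xs
countᵇ-∈ b {xs = y ∷ ys} (here refl) bx rewrite bx = s≤s z≤n
countᵇ-∈ b {xs = y ∷ ys} (there x∈) bx = ≤-trans (countᵇ-∈ b x∈ bx) (m≤n+m _ _)

sum-map-if-0 : (b : A → Bool) (k : ℕ) (xs : List A) →
               sum (map (λ x → if b x then 0 else k) xs) ≡ countᵇ (not ∘ b) xs * k
sum-map-if-0 b k []       = refl
sum-map-if-0 b k (x ∷ xs) with b x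
... | true  = sum-map-if-0 b k xs
... | false = cong (k +_) (sum-map-if-0 b k xs)

length-cartesianProductWith : (f : A → B → C) (xs : List A) (ys : List B) →
                              length (cartesianProductWith f xs ys) ≡ length xs * length ys
length-cartesianProductWith f []       ys = refl
length-cartesianProductWith f (x ∷ xs) ys = begin
  length (map (f x) ys ++ cartesianProductWith f xs ys)       ≡⟨ length-++ (map (f x) ys) ⟩
  length (map (f x) ys) + length (cartesianProductWith f xs ys) ≡⟨ cong₂ _+_ (length-map (f x) ys) (length-cartesianProductWith f xs ys) ⟩
  length ys + length xs * length ys ∎
  where open ≡-Reasoning

sum-map-cartesianProductWith : (h : C → ℕ) (f : A → B → C) (xs : List A) (ys : List B) →
  sum (map h (cartesianProductWith f xs ys)) ≡ sum (map (λ x → sum (map (λ y → h (f x y)) ys)) xs)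
sum-map-cartesianProductWith h f []       ys = refl
sum-map-cartesianProductWith h f (x ∷ xs) ys = begin
  sum (map h (map (f x) ys ++ cartesianProductWith f xs ys))
    ≡⟨ cong sum (map-++ h (map (f x) ys) _) ⟩
  sum (map h (map (f x) ys) ++ map h (cartesianProductWith f xs ys))
    ≡⟨ sum-++ (map h (map (f x) ys)) _ ⟩
  sum (map h (map (f x) ys)) + sum (map h (cartesianProductWith f xs ys))
    ≡⟨ cong₂ _+_ (cong sum (sym (map-∘ ys))) (sum-map-cartesianProductWith h f xs ys) ⟩
  sum (map (λ y → h (f x y)) ys) + sum (map (λ x → sum (map (λ y → h (f x y)) ys)) xs) ∎
  where open ≡-Reasoning

length-allFin : ∀ n → length (allFin n) ≡ n
length-allFin n = length-tabulate id

sequences : List A → ℕ → List (List A)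
sequences us zero    = [ [] ]
sequences us (suc m) = cartesianProductWith _∷_ us (sequences us m)

length-sequences : (us : List A) (m : ℕ) → length (sequences us m) ≡ length us ^ m
length-sequences us zero    = refl
length-sequences us (suc m) =
  trans (length-cartesianProductWith _∷_ us (sequences us m)) (cong (length us *_) (length-sequences us m))

sequences-length : (us : List A) (m : ℕ) → All (λ p → length p ≡ m) (sequences us m)
sequences-length us zero    = refl ∷ []
sequences-length us (suc m) =
  All.cartesianProductWith⁺ (setoid _) (setoid _) _∷_ us (sequences us m)
    (λ _ p∈ → cong suc (All.lookup (sequences-length us m) p∈))

-- Bernoulli's inequality (1 + 1/a)^k ≥ 1 + k/a, multiplied through by a^(k+1).
bernoulli : ∀ a k → a ^ k * (a + k) ≤ suc a ^ k * a
bernoulli a zero    = ≤-reflexive (cong (_+ 0) (+-identityʳ a))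
bernoulli a (suc k) = begin
  a ^ suc k * (a + suc k)               ≤⟨ m≤m+n _ (a ^ k * k) ⟩
  a * a ^ k * (a + suc k) + a ^ k * k   ≡⟨ solve 3 (λ a p k → a :* p :* (a :+ (con 1 :+ k)) :+ p :* k
                                                          := (p :* (a :+ k)) :* (con 1 :+ a)) refl a (a ^ k) k ⟩
  a ^ k * (a + k) * suc a               ≤⟨ *-monoˡ-≤ (suc a) (bernoulli a k) ⟩
  suc a ^ k * a * suc a                 ≡⟨ solve 3 (λ a q b → q :* a :* b := b :* q :* a) refl a (suc a ^ k) (suc a) ⟩
  suc a ^ suc k * a                     ∎
  where open ≤-Reasoning
        open +-*-Solver

half-power : ∀ a → 2 * a ^ suc a ≤ suc a ^ suc a
half-power zero       = z≤n
half-power a@(suc _) = *-cancelʳ-≤ (2 * a ^ suc a) (suc a ^ suc a) a (begin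
  2 * a ^ suc a * a          ≡⟨ solve 2 (λ a p → con 2 :* p :* a := p :* (a :+ a)) refl a (a ^ suc a) ⟩
  a ^ suc a * (a + a)        ≤⟨ *-monoʳ-≤ (a ^ suc a) (+-monoʳ-≤ a (n≤1+n a)) ⟩
  a ^ suc a * (a + suc a)    ≤⟨ bernoulli a (suc a) ⟩
  suc a ^ suc a * a          ∎)
  where open ≤-Reasoning
        open +-*-Solver

*-^-mono-≤ : ∀ {k x y} L → k * x ≤ y → k ^ L * x ^ L ≤ y ^ L
*-^-mono-≤         zero    _     = ≤-refl
*-^-mono-≤ {k} {x} {y} (suc L) kx≤y = begin
  k * k ^ L * (x * x ^ L)    ≡⟨ solve 4 (λ k p x q → k :* p :* (x :* q) := (k :* x) :* (p :* q)) refl k (k ^ L) x (x ^ L) ⟩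
  (k * x) * (k ^ L * x ^ L)  ≤⟨ *-mono-≤ kx≤y (*-^-mono-≤ L kx≤y) ⟩
  y * y ^ L                  ∎
  where open ≤-Reasoning
        open +-*-Solver

n<2^n : ∀ n → n < 2 ^ n
n<2^n zero    = s≤s z≤n
n<2^n (suc n) = ≤-trans (+-mono-≤ (m^n>0 2 n) (n<2^n n)) (≤-reflexive (cong (2 ^ n +_) (sym (+-identityʳ (2 ^ n)))))

decay : ∀ a → 2 * suc a * a ^ (suc a * suc (suc a)) ≤ suc a ^ (suc a * suc (suc a))
decay a = begin
  2 * n * a ^ (n * suc n)       ≤⟨ *-monoˡ-≤ _ (*-monoʳ-≤ 2 (<⇒≤ (n<2^n n))) ⟩
  2 ^ suc n * a ^ (n * suc n)   ≡⟨ cong (2 ^ suc n *_) (sym (^-*-assoc a n (suc n))) ⟩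
  2 ^ suc n * (a ^ n) ^ suc n   ≤⟨ *-^-mono-≤ {2} {a ^ n} {n ^ n} (suc n) (half-power a) ⟩
  (n ^ n) ^ suc n               ≡⟨ ^-*-assoc n n (suc n) ⟩
  n ^ (n * suc n)               ∎
  where open ≤-Reasoning
        n = suc a

recurrence-step-≤ : ∀ {n a c d N T Y} → c + d ≡ n → d ≤ a → T ≤ N * n + Y →
                    n * (N * c) + d * T ≤ n * N * n + a * Y
recurrence-step-≤ {n} {a} {c} {d} {N} {T} {Y} c+d≡n d≤a T≤ = begin
  n * (N * c) + d * T             ≤⟨ +-monoʳ-≤ (n * (N * c)) (*-monoʳ-≤ d T≤) ⟩
  n * (N * c) + d * (N * n + Y)   ≡⟨ solve 5 (λ n N c d Y → n :* (N :* c) :+ d :* (N :* n :+ Y)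
                                                := (n :* N) :* (c :+ d) :+ d :* Y) refl n N c d Y ⟩
  n * N * (c + d) + d * Y         ≡⟨ cong (λ m → n * N * m + d * Y) c+d≡n ⟩
  n * N * n + d * Y               ≤⟨ +-monoʳ-≤ (n * N * n) (*-monoˡ-≤ Y d≤a) ⟩
  n * N * n + a * Y               ∎
  where open ≤-Reasoning
        open +-*-Solver

three-halves-bound : ∀ n N A S → 2 * n * A ≤ N → S ≤ N * n + A * (n * n) → 2 * S ≤ 3 * n * N
three-halves-bound n N A S 2nA≤N S≤ = begin
  2 * S                          ≤⟨ *-monoʳ-≤ 2 S≤ ⟩
  2 * (N * n + A * (n * n))      ≡⟨ solve 3 (λ N n A → con 2 :* (N :* n :+ A :* (n :* n))
                                              := con 2 :* N :* n :+ n :* (con 2 :* n :* A)) refl N n A ⟩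
  2 * N * n + n * (2 * n * A)    ≤⟨ +-monoʳ-≤ (2 * N * n) (*-monoʳ-≤ n 2nA≤N) ⟩
  2 * N * n + n * N              ≡⟨ solve 2 (λ N n → con 2 :* N :* n :+ n :* N := con 3 :* n :* N) refl N n ⟩
  3 * n * N                      ∎
  where open ≤-Reasoning
        open +-*-Solver

≡ᵇ-refl : ∀ m → (m ≡ᵇ m) ≡ true
≡ᵇ-refl m = Equivalence.to T-≡ (≡⇒≡ᵇ m m refl)

module SourceInfection {n : ℕ} (G : Graph n) (lab : Fin n → Fin n → ℕ) (δ : ℕ) (s : Fin n) (t₀ : ℕ) where
  open SIR G lab δ s t₀

  stateAfter-mono : ∀ t u → is-just (stateAfter t u) ≡ true → is-just (stateAfter (suc t) u) ≡ true
  stateAfter-mono t u infected with stateAfter t u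
  ... | just _ = refl

  stateAfter-seed : ∀ t → suc t ≡ t₀ → is-just (stateAfter (suc t) s) ≡ true
  stateAfter-seed t seed with stateAfter t s
  ... | just _  = refl
  ... | nothing with s Fin.≟ s
  ...   | no s≢s = contradiction refl s≢s
  ...   | yes _ rewrite sym seed | ≡ᵇ-refl t = refl

  source-infected : ∀ T → 1 ≤ t₀ → t₀ ≤ T → is-just (stateAfter T s) ≡ true
  source-infected zero    1≤t₀ t₀≤0 = contradiction (≤-trans 1≤t₀ t₀≤0) λ ()
  source-infected (suc t) 1≤t₀ t₀≤T with m≤n⇒m<n∨m≡n t₀≤T
  ... | inj₁ t₀<T = stateAfter-mono t s (source-infected t 1≤t₀ (m<1+n⇒m≤n t₀<T))
  ... | inj₂ t₀≡T = stateAfter-seed t (sym t₀≡T)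

hitSeen : {n : ℕ} → History n → Bool
hitSeen = any (is-just ∘ proj₂)

NoHit : {n : ℕ} → Fin n × Obs n → Set
NoHit (_ , o) = is-just o ≡ false

hitSeen-noHit : {n : ℕ} {h : History n} → All NoHit h → hitSeen h ≡ false
hitSeen-noHit []                 = refl
hitSeen-noHit (noHit ∷ noHits) rewrite noHit = hitSeen-noHit noHits

hitSeen-++ʳ : {n : ℕ} (h : History n) {h′ : History n} → hitSeen h′ ≡ true → hitSeen (h ++ h′) ≡ true
hitSeen-++ʳ []      seen = seen
hitSeen-++ʳ ((_ , o) ∷ h) seen = trans (cong (is-just o ∨_) (hitSeen-++ʳ h seen)) (∨-zeroʳ (is-just o))

watchInOrder : {n : ℕ} → List (Fin n) → Strategy n
watchInOrder ws h = if hitSeen h then nothing else head (drop (length h) ws)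

drop-suc : (i : ℕ) (xs : List A) {y : A} {ys : List A} → drop i xs ≡ y ∷ ys → drop (suc i) xs ≡ ys
drop-suc zero    (x ∷ xs) refl = refl
drop-suc (suc i) (x ∷ xs) eq   = drop-suc i xs eq

module Runs {n : ℕ} (G : Graph n) (lab : Fin n → Fin n → ℕ) (δ : ℕ)
            (s : Fin n) (Tmax : ℕ) (ts : ℕ → ℕ) where
  open Game G lab δ s Tmax ts

  hit : ℕ → Fin n → Bool
  hit i u = is-just (observe i u)

  module _ (σ : Strategy n) {h : History n} where

    run-suc-done : ∀ {k} → run σ k ≡ done h → run σ (suc k) ≡ done h
    run-suc-done r rewrite r = refl

    run-suc-stop : ∀ {k} → run σ k ≡ going h → σ h ≡ nothing → run σ (suc k) ≡ done h
    run-suc-stop r stop rewrite r | stop = refl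

    run-suc-watch : ∀ {k w} → run σ k ≡ going h → σ h ≡ just w →
                    run σ (suc k) ≡ going (h ++ [ (w , observe (length h) w) ])
    run-suc-watch r watch rewrite r | watch = refl

    run-done-+ : ∀ {k} → run σ k ≡ done h → ∀ j → run σ (j + k) ≡ done h
    run-done-+ r zero    = r
    run-done-+ {k} r (suc j) = run-suc-done {j + k} (run-done-+ r j)

    run-done-≤ : ∀ {k} → run σ k ≡ done h → ∀ {K} → k ≤ K → run σ K ≡ done h
    run-done-≤ {k} r {K} k≤K = subst (λ K → run σ K ≡ done h) (m∸n+n≡m k≤K) (run-done-+ r (K ∸ k))

  play : ℕ → List (Fin n) → History n
  play i []       = []
  play i (w ∷ ws) = (w , observe i w) ∷ (if hit i w then [] else play (suc i) ws)

  run-watchInOrder : ∀ ws rest {k i h} → run (watchInOrder ws) k ≡ going h → All NoHit h →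
                     length h ≡ i → drop i ws ≡ rest →
                     ∀ {K} → k + length rest < K → run (watchInOrder ws) K ≡ done (h ++ play i rest)
  run-watchInOrder ws [] {k} {h = h} r noHits refl rest≡ {K} k<K =
    subst (λ h′ → run σ K ≡ done h′) (sym (++-identityʳ h))
      (run-done-≤ σ (run-suc-stop σ {k = k} r stop) (subst (_< K) (+-identityʳ k) k<K))
    where
    σ = watchInOrder ws
    stop : σ h ≡ nothing
    stop rewrite hitSeen-noHit noHits | rest≡ = refl
  run-watchInOrder ws (w ∷ rest) {k} {h = h} r noHits refl rest≡ {K} k<K = continue (hit (length h) w) refl
    where
    σ = watchInOrder ws
    x = (w , observe (length h) w)
    watch : σ h ≡ just w
    watch rewrite hitSeen-noHit noHits | rest≡ = refl
    r′ : run σ (suc k) ≡ going (h ++ [ x ])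
    r′ = run-suc-watch σ {k = k} r watch
    continue : ∀ b → hit (length h) w ≡ b →
               run σ K ≡ done (h ++ x ∷ (if b then [] else play (suc (length h)) rest))
    continue true  hit? = run-done-≤ σ (run-suc-stop σ {k = suc k} r′ stop) (≤-trans (s≤s (m<m+n k z<s)) k<K)
      where
      stop : σ (h ++ [ x ]) ≡ nothing
      stop rewrite hitSeen-++ʳ h {[ x ]} (trans (∨-identityʳ _) hit?) = refl
    continue false hit? = subst (λ h′ → run σ K ≡ done h′) (++-assoc h [ x ] _)
      (run-watchInOrder ws rest r′ (All.++⁺ noHits (hit? ∷ [])) (trans (length-++ h) (+-comm (length h) 1))
        (drop-suc (length h) ws rest≡) (subst (_< K) (+-suc k (length rest)) k<K))

  run-watchInOrder-done : ∀ ws {K} → length ws < K → run (watchInOrder ws) K ≡ done (play 0 ws)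
  run-watchInOrder-done ws = run-watchInOrder ws ws {k = 0} refl [] refl refl

  play-success : ∀ i ws → s ∈ ws → (∀ j → hit j s ≡ true) → Success (play i ws)
  play-success i (w ∷ ws) s∈ source-hit with hit i w in hit?
  play-success i (w ∷ ws) s∈          source-hit | true  = here hit?
  play-success i (w ∷ ws) (here refl) source-hit | false = contradiction (trans (sym (source-hit i)) hit?) λ ()
  play-success i (w ∷ ws) (there s∈)  source-hit | false = there (play-success (suc i) ws s∈ source-hit)

  infected : ℕ → ℕ
  infected i = infectedCount G lab δ s (ts i) Tmax

  infected≤n : ∀ i → infected i ≤ n
  infected≤n i = subst (infected i ≤_) (length-allFin n) (countᵇ≤length (hit i) (allFin n))

  playCost : ℕ → List (Fin n) → ℕ
  playCost i []       = 0
  playCost i (w ∷ ws) = infected i + (if hit i w then 0 else playCost (suc i) ws)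

  costRounds-play : ∀ i ws → costRounds (i + length (play i ws)) ≡ costRounds i + playCost i ws
  costRounds-play i []       = trans (cong costRounds (+-identityʳ i)) (sym (+-identityʳ (costRounds i)))
  costRounds-play i (w ∷ ws) with hit i w
  ... | true  rewrite +-comm i 1 | +-identityʳ (infected i) = refl
  ... | false rewrite +-suc i (length (play (suc i) ws)) | costRounds-play (suc i) ws =
    +-assoc (costRounds i) (infected i) (playCost (suc i) ws)

  playCost-≤ : ∀ i ws → playCost i ws ≤ n * length ws
  playCost-≤ i []       = z≤n
  playCost-≤ i (w ∷ ws) = ≤-trans (first-round (hit i w)) (≤-reflexive (sym (*-suc n (length ws))))
    where
    first-round : ∀ b → infected i + (if b then 0 else playCost (suc i) ws) ≤ n + n * length ws
    first-round true  = ≤-trans (≤-reflexive (+-identityʳ (infected i))) (m≤n⇒m≤n+o _ (infected≤n i))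
    first-round false = +-mono-≤ (infected≤n i) (playCost-≤ (suc i) ws)

module Averaging {a : ℕ} (G : Graph (suc a)) (lab : Fin (suc a) → Fin (suc a) → ℕ) (δ : ℕ)
                 (s : Fin (suc a)) (Tmax : ℕ) (ts : ℕ → ℕ) where
  open Runs G lab δ s Tmax ts

  private
    n = suc a

  missed : ℕ → ℕ
  missed i = countᵇ (not ∘ hit i) (allFin n)

  infected+missed : ∀ i → infected i + missed i ≡ n
  infected+missed i = trans (countᵇ+countᵇ-not (hit i) (allFin n)) (length-allFin n)

  -- n ^ m times the expected cost, from round i on, of watching m uniformly random nodes and then F.
  playCostSum : ℕ → ℕ → List (Fin n) → ℕ
  playCostSum m i F = sum (map (λ p → playCost i (p ++ F)) (sequences (allFin n) m))

  length-sequences-allFin : ∀ m → length (sequences (allFin n) m) ≡ n ^ m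
  length-sequences-allFin m = trans (length-sequences (allFin n) m) (cong (_^ m) (length-allFin n))

  playCostSum-suc : ∀ m i F → playCostSum (suc m) i F ≡ n * (n ^ m * infected i) + missed i * playCostSum m (suc i) F
  playCostSum-suc m i F = begin
    playCostSum (suc m) i F
      ≡⟨ sum-map-cartesianProductWith (λ p → playCost i (p ++ F)) _∷_ (allFin n) ps ⟩
    sum (map (λ u → sum (map (λ p → playCost i (u ∷ p ++ F)) ps)) (allFin n))
      ≡⟨ cong sum (map-cong first-watch (allFin n)) ⟩
    sum (map (λ u → n ^ m * infected i + (if hit i u then 0 else P)) (allFin n))
      ≡⟨ sum-map-+ (λ _ → n ^ m * infected i) (λ u → if hit i u then 0 else P) (allFin n) ⟩
    sum (map (λ _ → n ^ m * infected i) (allFin n)) + sum (map (λ u → if hit i u then 0 else P) (allFin n))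
      ≡⟨ cong₂ _+_ (trans (sum-map-const _ (allFin n)) (cong (_* (n ^ m * infected i)) (length-allFin n)))
                   (sum-map-if-0 (hit i) P (allFin n)) ⟩
    n * (n ^ m * infected i) + missed i * P ∎
    where
    open ≡-Reasoning
    ps = sequences (allFin n) m
    P = playCostSum m (suc i) F
    rounds-cost : ∀ k → sum (map (λ _ → k) ps) ≡ n ^ m * k
    rounds-cost k = trans (sum-map-const k ps) (cong (_* k) (length-sequences-allFin m))
    first-watch : ∀ u → sum (map (λ p → playCost i (u ∷ p ++ F)) ps) ≡ n ^ m * infected i + (if hit i u then 0 else P)
    first-watch u with hit i u
    ... | true  rewrite +-identityʳ (infected i) = trans (rounds-cost (infected i)) (sym (+-identityʳ _))
    ... | false = trans (sum-map-+ (λ _ → infected i) (λ p → playCost (suc i) (p ++ F)) ps)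
                        (cong (_+ P) (rounds-cost (infected i)))

  module _ (source-hit : ∀ i → hit i s ≡ true) where

    missed≤a : ∀ i → missed i ≤ a
    missed≤a i = ≤-pred (≤-trans (+-monoˡ-≤ (missed i) (countᵇ-∈ (hit i) (∈-allFin s) (source-hit i)))
                                 (≤-reflexive (infected+missed i)))

    -- n ^ m * n bounds the random rounds; a ^ m * (n * n) is the fallback F, reached with probability (a / n) ^ m.
    playCostSum-≤ : ∀ F → (∀ j → playCost j F ≤ n * n) → ∀ m i → playCostSum m i F ≤ n ^ m * n + a ^ m * (n * n)
    playCostSum-≤ F F≤ zero i = begin
      playCost i F + 0       ≡⟨ +-identityʳ _ ⟩
      playCost i F           ≤⟨ F≤ i ⟩
      n * n                  ≤⟨ m≤n+m (n * n) (1 * n) ⟩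
      1 * n + n * n          ≡⟨ cong (1 * n +_) (sym (*-identityˡ (n * n))) ⟩
      1 * n + 1 * (n * n)    ∎
      where open ≤-Reasoning
    playCostSum-≤ F F≤ (suc m) i = begin
      playCostSum (suc m) i F
        ≡⟨ playCostSum-suc m i F ⟩
      n * (n ^ m * infected i) + missed i * playCostSum m (suc i) F
        ≤⟨ recurrence-step-≤ {c = infected i} {N = n ^ m} (infected+missed i) (missed≤a i) (playCostSum-≤ F F≤ m (suc i)) ⟩
      n * n ^ m * n + a * (a ^ m * (n * n))
        ≡⟨ cong (n * n ^ m * n +_) (sym (*-assoc a (a ^ m) (n * n))) ⟩
      n ^ suc m * n + a ^ suc m * (n * n) ∎
      where open ≤-Reasoning

fromListWithDefault : A → List A → List⁺ A
fromListWithDefault d []       = d ∷ []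
fromListWithDefault d (x ∷ xs) = x ∷ xs

toList-fromListWithDefault : (d : A) (xs : List A) → 1 ≤ length xs → toList (fromListWithDefault d xs) ≡ xs
toList-fromListWithDefault d (x ∷ xs) _ = refl

randomRounds : ℕ → ℕ
randomRounds n = n * suc n

watchers : (n : ℕ) → List (Strategy n)
watchers n = map (λ p → watchInOrder (p ++ allFin n)) (sequences (allFin n) (randomRounds n))

randomWatcher : (n : ℕ) → RandStrategy n
randomWatcher n = fromListWithDefault (λ _ → nothing) (watchers n)

module Winning {a : ℕ} (G : Graph (suc a)) (lab : Fin (suc a) → Fin (suc a) → ℕ) (δ : ℕ)
               (s : Fin (suc a)) (Tmax : ℕ) (ts : ℕ → ℕ) (valid : ∀ i → 1 ≤ ts i × ts i ≤ Tmax) where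
  open Game G lab δ s Tmax ts
  open Runs G lab δ s Tmax ts
  open Averaging G lab δ s Tmax ts

  private
    n = suc a
    R = randomRounds n
    F = allFin n
    K = suc (R + n)

  -- Wins D unfolds to WinsOnAverage (toList D).
  WinsOnAverage : List (Strategy n) → Set
  WinsOnAverage σs = Σ ℕ λ k →
    All (λ σ → IsDone (run σ k)) σs ×
    All (λ σ → Success (hist (run σ k))) σs ×
    2 * sum (map (λ σ → cost (hist (run σ k))) σs) ≤ 3 * n * length σs

  source-hit : ∀ i → hit i s ≡ true
  source-hit i = SourceInfection.source-infected G lab δ s (ts i) Tmax (proj₁ (valid i)) (proj₂ (valid i))

  module _ {p : List (Fin n)} (|p|≡R : length p ≡ R) where

    run-watcher : run (watchInOrder (p ++ F)) K ≡ done (play 0 (p ++ F))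
    run-watcher = run-watchInOrder-done (p ++ F)
      (≤-reflexive (cong suc (trans (length-++ p) (cong₂ _+_ |p|≡R (length-allFin n)))))

    watcher-done : IsDone (run (watchInOrder (p ++ F)) K)
    watcher-done rewrite run-watcher = tt

    watcher-success : Success (hist (run (watchInOrder (p ++ F)) K))
    watcher-success rewrite run-watcher = play-success 0 (p ++ F) (∈-++⁺ʳ p (∈-allFin s)) source-hit

    watcher-cost : cost (hist (run (watchInOrder (p ++ F)) K)) ≡ playCost 0 (p ++ F)
    watcher-cost rewrite run-watcher = costRounds-play 0 (p ++ F)

  length-watchers : length (watchers n) ≡ n ^ R
  length-watchers = trans (length-map _ (sequences F R)) (length-sequences-allFin R)

  watchers-cost : sum (map (λ σ → cost (hist (run σ K))) (watchers n)) ≡ playCostSum R 0 F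
  watchers-cost = cong sum (trans (sym (map-∘ (sequences F R)))
                                  (map-cong-local (All.map watcher-cost (sequences-length F R))))

  watchers-win : WinsOnAverage (watchers n)
  watchers-win = K
    , All.map⁺ (All.map watcher-done (sequences-length F R))
    , All.map⁺ (All.map watcher-success (sequences-length F R))
    , (begin
      2 * sum (map (λ σ → cost (hist (run σ K))) (watchers n)) ≡⟨ cong (2 *_) watchers-cost ⟩
      2 * playCostSum R 0 F                                   ≤⟨ three-halves-bound n (n ^ R) (a ^ R) _ (decay a)
                                                                   (playCostSum-≤ source-hit F F≤ R 0) ⟩
      3 * n * n ^ R                                           ≡⟨ cong (3 * n *_) (sym length-watchers) ⟩
      3 * n * length (watchers n)                             ∎)
    where
    open ≤-Reasoning
    F≤ : ∀ j → playCost j F ≤ n * n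
    F≤ j = subst (λ l → playCost j F ≤ n * l) (length-allFin n) (playCost-≤ j F)

  randomWatcher-wins : Wins (randomWatcher n)
  randomWatcher-wins = subst WinsOnAverage
    (sym (toList-fromListWithDefault _ (watchers n) (subst (1 ≤_) (sym length-watchers) (m^n>0 n R))))
    watchers-win

validSeeds⇒inRange : ∀ b {Tmax ts} → ValidSeeds b Tmax ts → ∀ i → 1 ≤ ts i × ts i ≤ Tmax
validSeeds⇒inRange consistent         valid = proj₁ valid
validSeeds⇒inRange obliviouslyDynamic valid = valid

mainTheorem17 : (k : Knowledge) (b : Behaviour) (n Tmax δ : ℕ) → 1 ≤ δ →
    Σ (Info k n → RandStrategy n) λ D →
      (G : Graph n) (L : Labeling G Tmax) (s : Fin n) (ts : ℕ → ℕ) →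
      ValidSeeds b Tmax ts →
      Game.Wins G (lab L) δ s Tmax ts (D (info k G))
mainTheorem17 k b n Tmax δ _ = (λ _ → randomWatcher n) , wins n
  where
  wins : ∀ n (G : Graph n) (L : Labeling G Tmax) (s : Fin n) (ts : ℕ → ℕ) → ValidSeeds b Tmax ts →
         Game.Wins G (lab L) δ s Tmax ts (randomWatcher n)
  wins zero    G L () ts valid
  wins (suc a) G L s  ts valid = Winning.randomWatcher-wins G (lab L) δ s Tmax ts (validSeeds⇒inRange b valid)
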